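{- Let $A$ and $A'$ be valise $(4,1)$ adinkras on the same labeled vertex set, with operators $\phi_*$ and $\phi'_*$. For any colors $I<J$, with $K<L$ the complementary colors ($\{K,L\}=\{1,2,3,4\}\setminus\{I,J\}$), we have $\phi_{IJ}\phi'_{IJ}=\chi_0(A)\chi_0(A')\,\phi_{KL}\phi'_{KL}$.
   Context: Vertices: bosons $B=\{b_1,\dots,b_4\}$, fermions $F=\{f_1,\dots,f_4\}$. A valise $(4,1)$ adinkra is $K_{4,4}$ between $B$ and $F$ with edges colored by $\{1,2,3,4\}$ (each vertex has one edge of each color; any two colors form a disjoint union of $4$-cycles) and an odd dashing (every two-colored $4$-cycle has an odd number of dashed edges). For color $I$, $L_I$ is the $4\times4$ matrix (rows bosons, columns fermions) with $(i,j)$ entry $+1$/$-1$ if $b_i,f_j$ are joined by a solid/dashed edge of color $I$, else $0$; $R_I=L_I^T$; with basis ordered fermions first, $\phi_I=\begin{bmatrix}0&R_I\\L_I&0\end{bmatrix}$ and $\phi_{IJ}=\phi_I\phi_J$. The chirality $\chi_0(A)\in\{\pm1\}$ is the sign with $\phi_1\phi_2\phi_3\phi_4=\begin{bmatrix}-\chi_0(A)\mathbb{1}_4&0\\0&\chi_0(A)\mathbb{1}_4\end{bmatrix}$. -}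

module Defs where

open import Data.Fin using (Fin; zero; suc)
open import Data.Integer using (ℤ; +_; -_; _+_; _*_; -1ℤ; 1ℤ; 0ℤ)
open import Data.Bool using (Bool; true; false; if_then_else_; _xor_)
open import Data.Sum using (_⊎_; inj₁; inj₂)
open import Data.Product using (_×_; Σ; ∃-syntax)
open import Relation.Binary.PropositionalEquality using (_≡_; _≢_)
open import Relation.Nullary using (does)
open import Data.Fin using (_≟_)

-- Colors are Fin 4 (color 1,...,4 of the paper = 0,...,3, order preserved).
-- Bosons b_1..b_4 and fermions f_1..f_4 are indexed by Fin 4.
Color = Fin 4

-- Since the underlying graph is K_{4,4}, every pair (b_i, f_j) is joined by
-- exactly one edge; 'col i j' is its color and 'dashed i j' says whether it
-- is dashed.
record Adinkra : Set where
  field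
    col    : Fin 4 → Fin 4 → Color
    dashed : Fin 4 → Fin 4 → Bool
    boson-proper   : ∀ i I → ∃[ j ] (col i j ≡ I) × (∀ j' → col i j' ≡ I → j' ≡ j)
    fermion-proper : ∀ j I → ∃[ i ] (col i j ≡ I) × (∀ i' → col i' j ≡ I → i' ≡ i)
    -- any two colors form a disjoint union of 4-cycles: starting at any
    -- boson b_i, following color I to f_j, and color J back from b_i to f_j',
    -- there is a boson b_i' joined to f_j by color J and to f_j' by color I.
    four-cycles : ∀ I J → I ≢ J → ∀ i j j' → col i j ≡ I → col i j' ≡ J →
                  ∃[ i' ] (col i' j ≡ J) × (col i' j' ≡ I)
    odd-dashing : ∀ I J → I ≢ J → ∀ i i' j j' →
                  col i j ≡ I → col i' j ≡ J → col i' j' ≡ I → col i j' ≡ J →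
                  ((dashed i j xor dashed i' j) xor (dashed i' j' xor dashed i j')) ≡ true

open Adinkra public

-- L_I : rows bosons, columns fermions
Lmat : Adinkra → Color → Fin 4 → Fin 4 → ℤ
Lmat A I i j = if does (col A i j ≟ I)
                 then (if dashed A i j then -1ℤ else 1ℤ)
                 else 0ℤ

Rmat : Adinkra → Color → Fin 4 → Fin 4 → ℤ
Rmat A I j i = Lmat A I i j

-- index set of the 8x8 matrices: fermions first (inj₁), then bosons (inj₂)
Idx : Set
Idx = Fin 4 ⊎ Fin 4

Mat : Set
Mat = Idx → Idx → ℤ

sum4 : (Fin 4 → ℤ) → ℤ
sum4 f = f zero + (f (suc zero) + (f (suc (suc zero)) + f (suc (suc (suc zero)))))

sumIdx : (Idx → ℤ) → ℤ
sumIdx f = sum4 (λ k → f (inj₁ k)) + sum4 (λ k → f (inj₂ k))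

_⊗_ : Mat → Mat → Mat
(M ⊗ N) x y = sumIdx (λ z → M x z * N z y)

infixl 7 _⊗_

_·_ : ℤ → Mat → Mat
(c · M) x y = c * M x y

_≐_ : Mat → Mat → Set
M ≐ N = ∀ x y → M x y ≡ N x y

phi : Adinkra → Color → Mat
phi A I (inj₁ j) (inj₂ i) = Rmat A I j i
phi A I (inj₂ i) (inj₁ j) = Lmat A I i j
phi A I (inj₁ _) (inj₁ _) = 0ℤ
phi A I (inj₂ _) (inj₂ _) = 0ℤ

phi2 : Adinkra → Color → Color → Mat
phi2 A I J = phi A I ⊗ phi A J

delta : Fin 4 → Fin 4 → ℤ
delta a b = if does (a ≟ b) then 1ℤ else 0ℤ

chiBlock : ℤ → Mat
chiBlock χ (inj₁ a) (inj₁ b) = - χ * delta a b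
chiBlock χ (inj₂ a) (inj₂ b) = χ * delta a b
chiBlock χ (inj₁ _) (inj₂ _) = 0ℤ
chiBlock χ (inj₂ _) (inj₁ _) = 0ℤ

c1 c2 c3 c4 : Color
c1 = zero
c2 = suc zero
c3 = suc (suc zero)
c4 = suc (suc (suc zero))

IsChirality : Adinkra → ℤ → Set
IsChirality A χ = (χ ≡ 1ℤ ⊎ χ ≡ -1ℤ) ×
  ((phi A c1 ⊗ phi A c2 ⊗ phi A c3 ⊗ phi A c4) ≐ chiBlock χ)

-- The adinkra axioms say that the φ_I satisfy the Clifford relations φ_I² = 1 and
-- φ_I φ_J = −φ_J φ_I for I ≠ J: a color-I and a color-J edge at a vertex close up to a
-- two-colored 4-cycle, whose odd dashing makes the two contributions to the anticommutator
-- cancel. For complementary pairs {I,J}, {K,L}, reordering φ_I φ_J φ_K φ_L into φ₁φ₂φ₃φ₄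
-- costs a sign s depending only on the colors, so φ_I φ_J φ_K φ_L = s χ₀ G with
-- G = diag(−1, 1) the grading, and hence φ_IJ = s χ₀ G φ_LK. Since G anticommutes with
-- every φ_K it commutes with φ_LK, and in φ_IJ φ'_IJ the factors G, s and the signs of
-- φ_LK = −φ_KL all square away, leaving χ₀(A) χ₀(A') φ_KL φ'_KL.

module Submission where

open import Defs
open import Data.Fin using (Fin; _<_)
open import Data.Integer using (ℤ; _*_)
open import Relation.Binary.PropositionalEquality using (_≢_)

open import Algebra.Bundles using (CommutativeRing)
open import Data.Bool using (Bool; true; false; _xor_; if_then_else_)
open import Data.Bool.Properties using (xor-∧-commutativeRing; xor-comm; xor-same)
open import Data.Fin using (zero; suc; _≟_)
open import Data.Fin.Properties using (<⇒≢)
open import Data.Integer using (_+_; -_; 0ℤ; 1ℤ; -1ℤ)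
open import Data.Integer.Properties
  using (+-identityˡ; +-identityʳ; *-identityˡ; *-identityʳ; *-zeroʳ; *-assoc; *-comm; *-distribˡ-+;
         *-commutativeSemigroup)
open import Data.Integer.Tactic.RingSolver using (solve-∀)
open import Data.Nat using (s≤s)
open import Data.Product using (Σ; _×_; _,_)
open import Data.Sum using (inj₁; inj₂)
open import Data.Sum.Properties using (inj₁-injective; inj₂-injective)
open import Data.Empty using (⊥-elim)
open import Function using (_∘_)
open import Level using (0ℓ)
open import Relation.Binary.Bundles using (Setoid)
import Relation.Binary.Reasoning.Setoid
open import Relation.Binary.PropositionalEquality
  using (_≡_; refl; sym; trans; cong; cong₂; subst; ≢-sym; module ≡-Reasoning)
open import Relation.Nullary using (Dec; yes; no)
open import Relation.Nullary.Decidable using (dec-true; dec-false)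

open import Algebra.Properties.CommutativeSemigroup
  (CommutativeRing.+-commutativeSemigroup xor-∧-commutativeRing)
  using (interchange)
open import Algebra.Properties.CommutativeSemigroup *-commutativeSemigroup
  using (x∙yz≈y∙xz)

-- Finite sums

sum4-cong : ∀ {f g : Fin 4 → ℤ} → (∀ k → f k ≡ g k) → sum4 f ≡ sum4 g
sum4-cong f≡g = cong₂ _+_ (f≡g _) (cong₂ _+_ (f≡g _) (cong₂ _+_ (f≡g _) (f≡g _)))

sum4-+ : (f g : Fin 4 → ℤ) → sum4 (λ k → f k + g k) ≡ sum4 f + sum4 g
sum4-+ f g = shuffle (f _) (f _) (f _) (f _) (g _) (g _) (g _) (g _)
  where
  shuffle : ∀ a b c d a' b' c' d' →
    (a + a') + ((b + b') + ((c + c') + (d + d'))) ≡ (a + (b + (c + d))) + (a' + (b' + (c' + d')))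
  shuffle = solve-∀

sum4-*ˡ : (c : ℤ) (f : Fin 4 → ℤ) → sum4 (λ k → c * f k) ≡ c * sum4 f
sum4-*ˡ c f = distrib c (f _) (f _) (f _) (f _)
  where
  distrib : ∀ c a b d e → c * a + (c * b + (c * d + c * e)) ≡ c * (a + (b + (d + e)))
  distrib = solve-∀

sum4-comm : (f : Fin 4 → Fin 4 → ℤ) → sum4 (λ a → sum4 (f a)) ≡ sum4 (λ b → sum4 (λ a → f a b))
sum4-comm f =
  trans (sum4-+ (λ a → f a zero) (λ a → f a one + (f a two + f a three)))
    (cong (sum4 (λ a → f a zero) +_) (trans (sum4-+ (λ a → f a one) (λ a → f a two + f a three))
      (cong (sum4 (λ a → f a one) +_) (sum4-+ (λ a → f a two) (λ a → f a three)))))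
  where
  one two three : Fin 4
  one = suc zero
  two = suc (suc zero)
  three = suc (suc (suc zero))

sum4-single : (f : Fin 4 → ℤ) (k : Fin 4) → (∀ i → i ≢ k → f i ≡ 0ℤ) → sum4 f ≡ f k
sum4-single f zero f≡0 =
  trans (cong (f zero +_) (cong₂ _+_ (f≡0 _ (λ ())) (cong₂ _+_ (f≡0 _ (λ ())) (f≡0 _ (λ ())))))
        (+-identityʳ _)
sum4-single f (suc zero) f≡0 =
  trans (cong₂ _+_ (f≡0 _ (λ ())) (cong (f (suc zero) +_) (cong₂ _+_ (f≡0 _ (λ ())) (f≡0 _ (λ ())))))
        (trans (+-identityˡ _) (+-identityʳ _))
sum4-single f (suc (suc zero)) f≡0 =
  trans (cong₂ _+_ (f≡0 _ (λ ())) (cong₂ _+_ (f≡0 _ (λ ())) (cong (f (suc (suc zero)) +_) (f≡0 _ (λ ())))))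
        (trans (+-identityˡ _) (trans (+-identityˡ _) (+-identityʳ _)))
sum4-single f (suc (suc (suc zero))) f≡0 =
  trans (cong₂ _+_ (f≡0 _ (λ ()))
                   (cong₂ _+_ (f≡0 _ (λ ())) (cong (_+ f (suc (suc (suc zero)))) (f≡0 _ (λ ())))))
        (trans (+-identityˡ _) (trans (+-identityˡ _) (+-identityˡ _)))

sumIdx-cong : ∀ {f g : Idx → ℤ} → (∀ x → f x ≡ g x) → sumIdx f ≡ sumIdx g
sumIdx-cong f≡g = cong₂ _+_ (sum4-cong (f≡g ∘ inj₁)) (sum4-cong (f≡g ∘ inj₂))

sumIdx-+ : (f g : Idx → ℤ) → sumIdx (λ x → f x + g x) ≡ sumIdx f + sumIdx g
sumIdx-+ f g =
  trans (cong₂ _+_ (sum4-+ (f ∘ inj₁) (g ∘ inj₁)) (sum4-+ (f ∘ inj₂) (g ∘ inj₂)))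
        (interchange4 (sum4 (f ∘ inj₁)) (sum4 (g ∘ inj₁)) (sum4 (f ∘ inj₂)) (sum4 (g ∘ inj₂)))
  where
  interchange4 : ∀ a b c d → (a + b) + (c + d) ≡ (a + c) + (b + d)
  interchange4 = solve-∀

sumIdx-*ˡ : (c : ℤ) (f : Idx → ℤ) → sumIdx (λ x → c * f x) ≡ c * sumIdx f
sumIdx-*ˡ c f = trans (cong₂ _+_ (sum4-*ˡ c (f ∘ inj₁)) (sum4-*ˡ c (f ∘ inj₂)))
                      (sym (*-distribˡ-+ c _ _))

sumIdx-sum4-comm : (f : Idx → Fin 4 → ℤ) → sumIdx (λ x → sum4 (f x)) ≡ sum4 (λ b → sumIdx (λ x → f x b))
sumIdx-sum4-comm f =
  trans (cong₂ _+_ (sum4-comm (f ∘ inj₁)) (sum4-comm (f ∘ inj₂)))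
        (sym (sum4-+ (λ b → sum4 (λ a → f (inj₁ a) b)) (λ b → sum4 (λ a → f (inj₂ a) b))))

sumIdx-comm : (f : Idx → Idx → ℤ) → sumIdx (λ x → sumIdx (f x)) ≡ sumIdx (λ y → sumIdx (λ x → f x y))
sumIdx-comm f =
  trans (sumIdx-+ (λ x → sum4 (f x ∘ inj₁)) (λ x → sum4 (f x ∘ inj₂)))
        (cong₂ _+_ (sumIdx-sum4-comm (λ x → f x ∘ inj₁)) (sumIdx-sum4-comm (λ x → f x ∘ inj₂)))

sumIdx-single : (f : Idx → ℤ) (x : Idx) → (∀ y → y ≢ x → f y ≡ 0ℤ) → sumIdx f ≡ f x
sumIdx-single f (inj₁ a) f≡0 =
  trans (cong₂ _+_ (sum4-single (f ∘ inj₁) a (λ i i≢a → f≡0 _ (i≢a ∘ inj₁-injective)))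
                   (sum4-cong {g = λ _ → 0ℤ} (λ k → f≡0 (inj₂ k) λ ())))
        (+-identityʳ _)
sumIdx-single f (inj₂ a) f≡0 =
  trans (cong₂ _+_ (sum4-cong {g = λ _ → 0ℤ} (λ k → f≡0 (inj₁ k) λ ()))
                   (sum4-single (f ∘ inj₂) a (λ i i≢a → f≡0 _ (i≢a ∘ inj₂-injective))))
        (+-identityˡ _)

-- Signs and the entries of L_I

xor-swap₂₄ : ∀ a b c d → (a xor b) xor (c xor d) ≡ (a xor d) xor (c xor b)
xor-swap₂₄ a b c d =
  trans (interchange a b c d) (trans (cong ((a xor c) xor_) (xor-comm b d)) (sym (interchange a d c b)))

sign : Bool → ℤ
sign b = if b then -1ℤ else 1ℤ

sign-xor : ∀ a b → sign a * sign b ≡ sign (a xor b)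
sign-xor false false = refl
sign-xor false true  = refl
sign-xor true  false = refl
sign-xor true  true  = refl

sign-square : ∀ b → sign b * sign b ≡ 1ℤ
sign-square b = trans (sign-xor b b) (cong sign (xor-same b))

signs-cancel : ∀ a b c d → (a xor b) xor (c xor d) ≡ true → sign a * sign b + sign c * sign d ≡ 0ℤ
signs-cancel a b c d odd = trans (cong₂ _+_ (sign-xor a b) (sign-xor c d)) (opposite (a xor b) (c xor d) odd)
  where
  opposite : ∀ x y → x xor y ≡ true → sign x + sign y ≡ 0ℤ
  opposite false true _ = refl
  opposite true false _ = refl

unit-cancels : ∀ {s} → s * s ≡ 1ℤ → ∀ a b → (s * a) * (s * b) ≡ a * b
unit-cancels {s} s²≡1 a b = begin
  (s * a) * (s * b)  ≡⟨ regroup s a b ⟩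
  (s * s) * (a * b)  ≡⟨ cong (_* (a * b)) s²≡1 ⟩
  1ℤ * (a * b)       ≡⟨ *-identityˡ (a * b) ⟩
  a * b              ∎
  where
  open ≡-Reasoning
  regroup : ∀ s a b → (s * a) * (s * b) ≡ (s * s) * (a * b)
  regroup = solve-∀

*-vanishʳ : ∀ a {b} → b ≡ 0ℤ → a * b ≡ 0ℤ
*-vanishʳ a refl = *-zeroʳ a

i+j≡0⇒i≡-1*j : ∀ {a b} → a + b ≡ 0ℤ → a ≡ -1ℤ * b
i+j≡0⇒i≡-1*j {a} {b} a+b≡0 = begin
  a                  ≡⟨ expand a b ⟩
  (a + b) + -1ℤ * b  ≡⟨ cong (_+ -1ℤ * b) a+b≡0 ⟩
  0ℤ + -1ℤ * b       ≡⟨ +-identityˡ (-1ℤ * b) ⟩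
  -1ℤ * b            ∎
  where
  open ≡-Reasoning
  expand : ∀ a b → a ≡ (a + b) + -1ℤ * b
  expand = solve-∀

delta-refl : ∀ a → delta a a ≡ 1ℤ
delta-refl a = cong (if_then 1ℤ else 0ℤ) (dec-true (a ≟ a) refl)

delta-≢ : ∀ {a b} → a ≢ b → delta a b ≡ 0ℤ
delta-≢ {a} {b} a≢b = cong (if_then 1ℤ else 0ℤ) (dec-false (a ≟ b) a≢b)

module _ (A : Adinkra) where

  col-injectiveˡ : ∀ {i i' j} → col A i j ≡ col A i' j → i ≡ i'
  col-injectiveˡ {i} {i'} {j} eq with fermion-proper A j (col A i j)
  ... | _ , _ , unique = trans (unique i refl) (sym (unique i' (sym eq)))

  col-injectiveʳ : ∀ {i j j'} → col A i j ≡ col A i j' → j ≡ j'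
  col-injectiveʳ {i} {j} {j'} eq with boson-proper A i (col A i j)
  ... | _ , _ , unique = trans (unique j refl) (sym (unique j' (sym eq)))

  Lmat-colored : ∀ {I i j} → col A i j ≡ I → Lmat A I i j ≡ sign (dashed A i j)
  Lmat-colored {I} {i} {j} ij≡I =
    cong (if_then sign (dashed A i j) else 0ℤ) (dec-true (col A i j ≟ I) ij≡I)

  Lmat-uncolored : ∀ {I i j} → col A i j ≢ I → Lmat A I i j ≡ 0ℤ
  Lmat-uncolored {I} {i} {j} ij≢I =
    cong (if_then sign (dashed A i j) else 0ℤ) (dec-false (col A i j ≟ I) ij≢I)

  Lmat-other-boson : ∀ {I i i' j} → col A i j ≡ I → i' ≢ i → Lmat A I i' j ≡ 0ℤ
  Lmat-other-boson ij≡I i'≢i =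
    Lmat-uncolored λ i'j≡I → i'≢i (col-injectiveˡ (trans i'j≡I (sym ij≡I)))

  Lmat-other-fermion : ∀ {I i j j'} → col A i j ≡ I → j' ≢ j → Lmat A I i j' ≡ 0ℤ
  Lmat-other-fermion ij≡I j'≢j =
    Lmat-uncolored λ ij'≡I → j'≢j (col-injectiveʳ (trans ij'≡I (sym ij≡I)))

  -- The square is closed from the boson i; the fermion j has a single J-edge, so its
  -- fourth vertex is i'.
  transpose-four-cycles : ∀ I J → I ≢ J → ∀ j i i' → col A i j ≡ I → col A i' j ≡ J →
                          Σ (Fin 4) λ j' → (col A i j' ≡ J) × (col A i' j' ≡ I)
  transpose-four-cycles I J I≢J j i i' ij≡I i'j≡J with boson-proper A i J
  ... | j' , ij'≡J , _ with four-cycles A I J I≢J i j j' ij≡I ij'≡J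
  ... | i'' , i''j≡J , i''j'≡I =
    j' , ij'≡J , subst (λ k → col A k j' ≡ I) (col-injectiveˡ (trans i''j≡J (sym i'j≡J))) i''j'≡I

-- Bosons and fermions exchanged: Lmat (transpose A) is Rmat A definitionally, so the
-- relations for R_I L_J are those for L_I R_J of the transposed adinkra.
transpose : Adinkra → Adinkra
transpose A = record
  { col            = λ j i → col A i j
  ; dashed         = λ j i → dashed A i j
  ; boson-proper   = fermion-proper A
  ; fermion-proper = boson-proper A
  ; four-cycles    = transpose-four-cycles A
  ; odd-dashing    = λ I J I≢J j j' i i' ij≡I ij'≡J i'j'≡I i'j≡J →
      trans (sym (xor-swap₂₄ (dashed A i j) (dashed A i' j) (dashed A i' j') (dashed A i j')))
            (odd-dashing A I J I≢J i i' j j' ij≡I i'j≡J i'j'≡I ij'≡J)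
  }

-- Garden algebra relations

LR : Adinkra → Color → Color → Fin 4 → Fin 4 → ℤ
LR A I J i i' = sum4 (λ j → Lmat A I i j * Rmat A J j i')

RL : Adinkra → Color → Color → Fin 4 → Fin 4 → ℤ
RL A I J j j' = sum4 (λ i → Rmat A I j i * Lmat A J i j')

module _ (A : Adinkra) where

  LR-at : ∀ {I} J {i j} → col A i j ≡ I → ∀ i' → LR A I J i i' ≡ Lmat A I i j * Lmat A J i' j
  LR-at {I} J {i} {j} ij≡I i' =
    sum4-single (λ k → Lmat A I i k * Lmat A J i' k) j λ k k≢j →
      cong (_* Lmat A J i' k) (Lmat-other-fermion A ij≡I k≢j)

  LR-diag : ∀ I i i' → LR A I I i i' ≡ delta i i'
  LR-diag I i i' with boson-proper A i I
  ... | j , ij≡I , _ = trans (LR-at I ij≡I i') (diag (i ≟ i'))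
    where
    diag : Dec (i ≡ i') → Lmat A I i j * Lmat A I i' j ≡ delta i i'
    diag (yes refl) =
      trans (cong₂ _*_ (Lmat-colored A ij≡I) (Lmat-colored A ij≡I))
            (trans (sign-square (dashed A i j)) (sym (delta-refl i)))
    diag (no i≢i') =
      trans (*-vanishʳ (Lmat A I i j) (Lmat-other-boson A ij≡I (≢-sym i≢i'))) (sym (delta-≢ i≢i'))

  LR-anticomm : ∀ {I J} → I ≢ J → ∀ i i' → LR A I J i i' + LR A J I i i' ≡ 0ℤ
  LR-anticomm {I} {J} I≢J i i' with boson-proper A i I | boson-proper A i J
  ... | j₁ , ij₁≡I , _ | j₂ , ij₂≡J , _ with four-cycles A I J I≢J i j₁ j₂ ij₁≡I ij₂≡J
  ... | i'' , i''j₁≡J , i''j₂≡I =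
    trans (cong₂ _+_ (LR-at J ij₁≡I i') (LR-at I ij₂≡J i')) (cycle (i' ≟ i''))
    where
    cycle : Dec (i' ≡ i'') → Lmat A I i j₁ * Lmat A J i' j₁ + Lmat A J i j₂ * Lmat A I i' j₂ ≡ 0ℤ
    cycle (yes refl) =
      trans (cong₂ _+_ (cong₂ _*_ (Lmat-colored A ij₁≡I) (Lmat-colored A i''j₁≡J))
                       (cong₂ _*_ (Lmat-colored A ij₂≡J) (Lmat-colored A i''j₂≡I)))
            (signs-cancel a b c d
              (trans (cong ((a xor b) xor_) (xor-comm c d))
                     (odd-dashing A I J I≢J i i'' j₁ j₂ ij₁≡I i''j₁≡J i''j₂≡I ij₂≡J)))
      where
      a = dashed A i j₁
      b = dashed A i'' j₁
      c = dashed A i j₂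
      d = dashed A i'' j₂
    cycle (no i'≢i'') =
      cong₂ _+_ (*-vanishʳ (Lmat A I i j₁) (Lmat-other-boson A i''j₁≡J i'≢i''))
                (*-vanishʳ (Lmat A J i j₂) (Lmat-other-boson A i''j₂≡I i'≢i''))

RL-diag : ∀ A I j j' → RL A I I j j' ≡ delta j j'
RL-diag A = LR-diag (transpose A)

RL-anticomm : ∀ A {I J} → I ≢ J → ∀ j j' → RL A I J j j' + RL A J I j j' ≡ 0ℤ
RL-anticomm A = LR-anticomm (transpose A)

≐-setoid : Setoid 0ℓ 0ℓ
≐-setoid = record
  { Carrier       = Mat
  ; _≈_           = _≐_
  ; isEquivalence = record
    { refl  = λ _ _ → refl
    ; sym   = λ M≐N x y → sym (M≐N x y)
    ; trans = λ M≐N N≐P x y → trans (M≐N x y) (N≐P x y)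
    }
  }

open Setoid ≐-setoid using () renaming (refl to ≐-refl; sym to ≐-sym; trans to ≐-trans)

module ≐-Reasoning = Relation.Binary.Reasoning.Setoid ≐-setoid

⊗-cong : ∀ {M M' N N'} → M ≐ M' → N ≐ N' → (M ⊗ N) ≐ (M' ⊗ N')
⊗-cong M≐M' N≐N' x y = sumIdx-cong λ z → cong₂ _*_ (M≐M' x z) (N≐N' z y)

⊗-congˡ : ∀ {M M'} N → M ≐ M' → (M ⊗ N) ≐ (M' ⊗ N)
⊗-congˡ N M≐M' = ⊗-cong M≐M' (≐-refl {N})

⊗-congʳ : ∀ M {N N'} → N ≐ N' → (M ⊗ N) ≐ (M ⊗ N')
⊗-congʳ M N≐N' = ⊗-cong (≐-refl {M}) N≐N'

⊗-assoc : ∀ M N P → ((M ⊗ N) ⊗ P) ≐ (M ⊗ (N ⊗ P))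
⊗-assoc M N P x y = begin
  sumIdx (λ z → sumIdx (λ w → M x w * N w z) * P z y)
    ≡⟨ sumIdx-cong (λ z → trans (*-comm _ (P z y)) (sym (sumIdx-*ˡ (P z y) (λ w → M x w * N w z)))) ⟩
  sumIdx (λ z → sumIdx (λ w → P z y * (M x w * N w z)))
    ≡⟨ sumIdx-comm (λ z w → P z y * (M x w * N w z)) ⟩
  sumIdx (λ w → sumIdx (λ z → P z y * (M x w * N w z)))
    ≡⟨ sumIdx-cong (λ w → trans (sumIdx-cong (λ z → regroup (P z y) (M x w) (N w z)))
                                 (sumIdx-*ˡ (M x w) (λ z → N w z * P z y))) ⟩
  sumIdx (λ w → M x w * sumIdx (λ z → N w z * P z y)) ∎
  where
  open ≡-Reasoning
  regroup : ∀ p m n → p * (m * n) ≡ m * (n * p)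
  regroup = solve-∀

·-cong : ∀ c {M N} → M ≐ N → (c · M) ≐ (c · N)
·-cong c M≐N x y = cong (c *_) (M≐N x y)

·-⊗-assoc : ∀ c M N → ((c · M) ⊗ N) ≐ (c · (M ⊗ N))
·-⊗-assoc c M N x y =
  trans (sumIdx-cong (λ z → *-assoc c (M x z) (N z y))) (sumIdx-*ˡ c (λ z → M x z * N z y))

⊗-·-comm : ∀ c M N → (M ⊗ (c · N)) ≐ (c · (M ⊗ N))
⊗-·-comm c M N x y =
  trans (sumIdx-cong (λ z → x∙yz≈y∙xz (M x z) c (N z y))) (sumIdx-*ˡ c (λ z → M x z * N z y))

·-· : ∀ c d M → (c · (d · M)) ≐ ((c * d) · M)
·-· c d M x y = sym (*-assoc c d (M x y))

1· : ∀ M → (1ℤ · M) ≐ M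
1· M x y = *-identityˡ (M x y)

·-⊗-· : ∀ c d M N → ((c · M) ⊗ (d · N)) ≐ ((c * d) · (M ⊗ N))
·-⊗-· c d M N = begin
  ((c · M) ⊗ (d · N))  ≈⟨ ·-⊗-assoc c M (d · N) ⟩
  (c · (M ⊗ (d · N)))  ≈⟨ ·-cong c (⊗-·-comm d M N) ⟩
  (c · (d · (M ⊗ N)))  ≈⟨ ·-· c d (M ⊗ N) ⟩
  ((c * d) · (M ⊗ N))  ∎
  where open ≐-Reasoning

blockDiag : (Fin 4 → Fin 4 → ℤ) → (Fin 4 → Fin 4 → ℤ) → Mat
blockDiag F B (inj₁ a) (inj₁ b) = F a b
blockDiag F B (inj₂ a) (inj₂ b) = B a b
blockDiag F B (inj₁ _) (inj₂ _) = 0ℤ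
blockDiag F B (inj₂ _) (inj₁ _) = 0ℤ

blockDiag-cong : ∀ {F F' B B'} → (∀ a b → F a b ≡ F' a b) → (∀ a b → B a b ≡ B' a b) →
                 blockDiag F B ≐ blockDiag F' B'
blockDiag-cong F≡F' B≡B' (inj₁ a) (inj₁ b) = F≡F' a b
blockDiag-cong F≡F' B≡B' (inj₂ a) (inj₂ b) = B≡B' a b
blockDiag-cong F≡F' B≡B' (inj₁ _) (inj₂ _) = refl
blockDiag-cong F≡F' B≡B' (inj₂ _) (inj₁ _) = refl

𝟙 : Mat
𝟙 = blockDiag delta delta

𝟙-refl : ∀ x → 𝟙 x x ≡ 1ℤ
𝟙-refl (inj₁ a) = delta-refl a
𝟙-refl (inj₂ a) = delta-refl a

𝟙-≢ : ∀ {x y} → x ≢ y → 𝟙 x y ≡ 0ℤ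
𝟙-≢ {inj₁ a} {inj₁ b} x≢y = delta-≢ (x≢y ∘ cong inj₁)
𝟙-≢ {inj₂ a} {inj₂ b} x≢y = delta-≢ (x≢y ∘ cong inj₂)
𝟙-≢ {inj₁ _} {inj₂ _} _ = refl
𝟙-≢ {inj₂ _} {inj₁ _} _ = refl

⊗-identityˡ : ∀ M → (𝟙 ⊗ M) ≐ M
⊗-identityˡ M x y =
  trans (sumIdx-single (λ z → 𝟙 x z * M z y) x (λ z z≢x → cong (_* M z y) (𝟙-≢ (≢-sym z≢x))))
        (trans (cong (_* M x y) (𝟙-refl x)) (*-identityˡ (M x y)))

⊗-identityʳ : ∀ M → (M ⊗ 𝟙) ≐ M
⊗-identityʳ M x y =
  trans (sumIdx-single (λ z → M x z * 𝟙 z y) y (λ z z≢y → *-vanishʳ (M x z) (𝟙-≢ z≢y)))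
        (trans (cong (M x y *_) (𝟙-refl y)) (*-identityʳ (M x y)))

-- Clifford relations and the grading

phi-product : ∀ A I J → (phi A I ⊗ phi A J) ≐ blockDiag (RL A I J) (LR A I J)
phi-product A I J (inj₁ j) (inj₁ j') = +-identityˡ (RL A I J j j')
phi-product A I J (inj₂ i) (inj₂ i') = +-identityʳ (LR A I J i i')
phi-product A I J (inj₁ j) (inj₂ i) =
  trans (+-identityˡ _) (sum4-cong {g = λ _ → 0ℤ} λ k → *-zeroʳ (Rmat A I j k))
phi-product A I J (inj₂ i) (inj₁ j) =
  trans (+-identityʳ _) (sum4-cong {g = λ _ → 0ℤ} λ k → *-zeroʳ (Lmat A I i k))

phi-square : ∀ A I → (phi A I ⊗ phi A I) ≐ 𝟙
phi-square A I = ≐-trans (phi-product A I I) (blockDiag-cong (RL-diag A I) (LR-diag A I))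

phi-anticomm : ∀ A {I J} → I ≢ J → (phi A I ⊗ phi A J) ≐ (-1ℤ · (phi A J ⊗ phi A I))
phi-anticomm A {I} {J} I≢J =
  ≐-trans (phi-product A I J)
          (≐-trans (negated (λ j j' → i+j≡0⇒i≡-1*j (RL-anticomm A I≢J j j'))
                            (λ i i' → i+j≡0⇒i≡-1*j (LR-anticomm A I≢J i i')))
                   (·-cong -1ℤ (≐-sym (phi-product A J I))))
  where
  negated : ∀ {F F' B B'} → (∀ a b → F a b ≡ -1ℤ * F' a b) → (∀ a b → B a b ≡ -1ℤ * B' a b) →
            blockDiag F B ≐ (-1ℤ · blockDiag F' B')
  negated F≡-F' B≡-B' (inj₁ a) (inj₁ b) = F≡-F' a b
  negated F≡-F' B≡-B' (inj₂ a) (inj₂ b) = B≡-B' a b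
  negated F≡-F' B≡-B' (inj₁ _) (inj₂ _) = refl
  negated F≡-F' B≡-B' (inj₂ _) (inj₁ _) = refl

parity : Idx → ℤ
parity (inj₁ _) = -1ℤ
parity (inj₂ _) = 1ℤ

grading : Mat
grading x y = parity x * 𝟙 x y

chiBlock-grading : ∀ χ → chiBlock χ ≐ (χ · grading)
chiBlock-grading χ (inj₁ a) (inj₁ b) = neg-inside χ (delta a b)
  where
  neg-inside : ∀ χ d → - χ * d ≡ χ * (-1ℤ * d)
  neg-inside = solve-∀
chiBlock-grading χ (inj₂ a) (inj₂ b) = cong (χ *_) (sym (*-identityˡ (delta a b)))
chiBlock-grading χ (inj₁ _) (inj₂ _) = sym (*-zeroʳ χ)
chiBlock-grading χ (inj₂ _) (inj₁ _) = sym (*-zeroʳ χ)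

grading-⊗ : ∀ M x y → (grading ⊗ M) x y ≡ parity x * M x y
grading-⊗ M x y =
  trans (sumIdx-cong (λ z → *-assoc (parity x) (𝟙 x z) (M z y)))
        (trans (sumIdx-*ˡ (parity x) (λ z → 𝟙 x z * M z y)) (cong (parity x *_) (⊗-identityˡ M x y)))

⊗-grading : ∀ M x y → (M ⊗ grading) x y ≡ parity y * M x y
⊗-grading M x y =
  trans (sumIdx-single (λ z → M x z * grading z y) y
                       (λ z z≢y → *-vanishʳ (M x z) (*-vanishʳ (parity z) (𝟙-≢ z≢y))))
        (trans (cong (λ e → M x y * (parity y * e)) (𝟙-refl y)) (move (M x y) (parity y)))
  where
  move : ∀ m p → m * (p * 1ℤ) ≡ p * m
  move = solve-∀

grading-anticomm-phi : ∀ A I → (grading ⊗ phi A I) ≐ (-1ℤ · (phi A I ⊗ grading))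
grading-anticomm-phi A I x y =
  trans (grading-⊗ (phi A I) x y) (trans (opposite-parity x y) (cong (-1ℤ *_) (sym (⊗-grading (phi A I) x y))))
  where
  opposite-parity : ∀ x y → parity x * phi A I x y ≡ -1ℤ * (parity y * phi A I x y)
  opposite-parity (inj₁ j) (inj₂ i) = cong (-1ℤ *_) (sym (*-identityˡ _))
  opposite-parity (inj₂ i) (inj₁ j) = double-neg (Lmat A I i j)
    where
    double-neg : ∀ a → 1ℤ * a ≡ -1ℤ * (-1ℤ * a)
    double-neg = solve-∀
  opposite-parity (inj₁ _) (inj₁ _) = refl
  opposite-parity (inj₂ _) (inj₂ _) = refl

grading-square : (grading ⊗ grading) ≐ 𝟙
grading-square x y = trans (grading-⊗ grading x y) (parity-square x (𝟙 x y))
  where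
  parity-square : ∀ x e → parity x * (parity x * e) ≡ e
  parity-square (inj₁ _) = solve-∀
  parity-square (inj₂ _) = solve-∀

⊗-comm-product : ∀ X P Q s t → (X ⊗ P) ≐ (s · (P ⊗ X)) → (X ⊗ Q) ≐ (t · (Q ⊗ X)) →
                 (X ⊗ (P ⊗ Q)) ≐ ((s * t) · ((P ⊗ Q) ⊗ X))
⊗-comm-product X P Q s t XP XQ = begin
  (X ⊗ (P ⊗ Q))                ≈⟨ ⊗-assoc X P Q ⟨
  ((X ⊗ P) ⊗ Q)                ≈⟨ ⊗-congˡ Q XP ⟩
  ((s · (P ⊗ X)) ⊗ Q)          ≈⟨ ·-⊗-assoc s (P ⊗ X) Q ⟩
  (s · ((P ⊗ X) ⊗ Q))          ≈⟨ ·-cong s (⊗-assoc P X Q) ⟩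
  (s · (P ⊗ (X ⊗ Q)))          ≈⟨ ·-cong s (⊗-congʳ P XQ) ⟩
  (s · (P ⊗ (t · (Q ⊗ X))))    ≈⟨ ·-cong s (⊗-·-comm t P (Q ⊗ X)) ⟩
  (s · (t · (P ⊗ (Q ⊗ X))))    ≈⟨ ·-· s t (P ⊗ (Q ⊗ X)) ⟩
  ((s * t) · (P ⊗ (Q ⊗ X)))    ≈⟨ ·-cong (s * t) (⊗-assoc P Q X) ⟨
  ((s * t) · ((P ⊗ Q) ⊗ X))    ∎
  where open ≐-Reasoning

anticomm-product : ∀ X P Q → (X ⊗ P) ≐ (-1ℤ · (P ⊗ X)) → (X ⊗ Q) ≐ (-1ℤ · (Q ⊗ X)) →
                   (X ⊗ (P ⊗ Q)) ≐ ((P ⊗ Q) ⊗ X)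
anticomm-product X P Q XP XQ = ≐-trans (⊗-comm-product X P Q -1ℤ -1ℤ XP XQ) (1· ((P ⊗ Q) ⊗ X))

comm-product : ∀ X P Q → (X ⊗ P) ≐ (P ⊗ X) → (X ⊗ Q) ≐ (Q ⊗ X) →
               (X ⊗ (P ⊗ Q)) ≐ ((P ⊗ Q) ⊗ X)
comm-product X P Q XP XQ =
  ≐-trans (⊗-comm-product X P Q 1ℤ 1ℤ (≐-trans XP (≐-sym (1· (P ⊗ X))))
                                       (≐-trans XQ (≐-sym (1· (Q ⊗ X)))))
          (1· ((P ⊗ Q) ⊗ X))

grading-comm-phi2 : ∀ A K L → (grading ⊗ phi2 A K L) ≐ (phi2 A K L ⊗ grading)
grading-comm-phi2 A K L =
  anticomm-product grading (phi A K) (phi A L) (grading-anticomm-phi A K) (grading-anticomm-phi A L)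

phi-comm-phi2 : ∀ A {I J K} → K ≢ I → K ≢ J → (phi A K ⊗ phi2 A I J) ≐ (phi2 A I J ⊗ phi A K)
phi-comm-phi2 A {I} {J} {K} K≢I K≢J =
  anticomm-product (phi A K) (phi A I) (phi A J) (phi-anticomm A K≢I) (phi-anticomm A K≢J)

phi2-comm-phi2 : ∀ A {I J K L} → K ≢ I → K ≢ J → L ≢ I → L ≢ J →
                 (phi2 A I J ⊗ phi2 A K L) ≐ (phi2 A K L ⊗ phi2 A I J)
phi2-comm-phi2 A {I} {J} {K} {L} K≢I K≢J L≢I L≢J =
  comm-product (phi2 A I J) (phi A K) (phi A L)
               (≐-sym (phi-comm-phi2 A K≢I K≢J)) (≐-sym (phi-comm-phi2 A L≢I L≢J))

phi2-inverse : ∀ A K L → (phi2 A K L ⊗ phi2 A L K) ≐ 𝟙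
phi2-inverse A K L = begin
  ((φK ⊗ φL) ⊗ (φL ⊗ φK))  ≈⟨ ⊗-assoc φK φL (φL ⊗ φK) ⟩
  (φK ⊗ (φL ⊗ (φL ⊗ φK)))  ≈⟨ ⊗-congʳ φK (⊗-assoc φL φL φK) ⟨
  (φK ⊗ ((φL ⊗ φL) ⊗ φK))  ≈⟨ ⊗-congʳ φK (⊗-congˡ φK (phi-square A L)) ⟩
  (φK ⊗ (𝟙 ⊗ φK))          ≈⟨ ⊗-congʳ φK (⊗-identityˡ φK) ⟩
  (φK ⊗ φK)                ≈⟨ phi-square A K ⟩
  𝟙                        ∎
  where
  open ≐-Reasoning
  φK = phi A K
  φL = phi A L

grading-cancel : ∀ M N → (grading ⊗ M) ≐ (M ⊗ grading) →
                 ((grading ⊗ M) ⊗ (grading ⊗ N)) ≐ (M ⊗ N)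
grading-cancel M N GM≐MG = begin
  ((G ⊗ M) ⊗ (G ⊗ N))  ≈⟨ ⊗-assoc G M (G ⊗ N) ⟩
  (G ⊗ (M ⊗ (G ⊗ N)))  ≈⟨ ⊗-congʳ G (⊗-assoc M G N) ⟨
  (G ⊗ ((M ⊗ G) ⊗ N))  ≈⟨ ⊗-congʳ G (⊗-congˡ N GM≐MG) ⟨
  (G ⊗ ((G ⊗ M) ⊗ N))  ≈⟨ ⊗-congʳ G (⊗-assoc G M N) ⟩
  (G ⊗ (G ⊗ (M ⊗ N)))  ≈⟨ ⊗-assoc G G (M ⊗ N) ⟨
  ((G ⊗ G) ⊗ (M ⊗ N))  ≈⟨ ⊗-congˡ (M ⊗ N) grading-square ⟩
  (𝟙 ⊗ (M ⊗ N))        ≈⟨ ⊗-identityˡ (M ⊗ N) ⟩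
  (M ⊗ N)              ∎
  where
  open ≐-Reasoning
  G = grading

-- Volume elements φ_I φ_J φ_K φ_L

volume : Adinkra → Color → Color → Color → Color → Mat
volume A I J K L = phi2 A I J ⊗ phi2 A K L

volume-chiBlock : ∀ A {χ} → (phi A c1 ⊗ phi A c2 ⊗ phi A c3 ⊗ phi A c4) ≐ chiBlock χ →
                  volume A c1 c2 c3 c4 ≐ (χ · grading)
volume-chiBlock A {χ} Γ≐χ =
  ≐-trans (≐-sym (⊗-assoc (phi2 A c1 c2) (phi A c3) (phi A c4))) (≐-trans Γ≐χ (chiBlock-grading χ))

volume-swap-middle : ∀ A {I J K L} → J ≢ K → volume A I J K L ≐ (-1ℤ · volume A I K J L)
volume-swap-middle A {I} {J} {K} {L} J≢K = begin
  ((φI ⊗ φJ) ⊗ (φK ⊗ φL))            ≈⟨ ⊗-assoc φI φJ (φK ⊗ φL) ⟩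
  (φI ⊗ (φJ ⊗ (φK ⊗ φL)))            ≈⟨ ⊗-congʳ φI (⊗-assoc φJ φK φL) ⟨
  (φI ⊗ ((φJ ⊗ φK) ⊗ φL))            ≈⟨ ⊗-congʳ φI (⊗-congˡ φL (phi-anticomm A J≢K)) ⟩
  (φI ⊗ ((-1ℤ · (φK ⊗ φJ)) ⊗ φL))    ≈⟨ ⊗-congʳ φI (·-⊗-assoc -1ℤ (φK ⊗ φJ) φL) ⟩
  (φI ⊗ (-1ℤ · ((φK ⊗ φJ) ⊗ φL)))    ≈⟨ ⊗-·-comm -1ℤ φI ((φK ⊗ φJ) ⊗ φL) ⟩
  (-1ℤ · (φI ⊗ ((φK ⊗ φJ) ⊗ φL)))    ≈⟨ ·-cong -1ℤ (⊗-congʳ φI (⊗-assoc φK φJ φL)) ⟩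
  (-1ℤ · (φI ⊗ (φK ⊗ (φJ ⊗ φL))))    ≈⟨ ·-cong -1ℤ (⊗-assoc φI φK (φJ ⊗ φL)) ⟨
  (-1ℤ · ((φI ⊗ φK) ⊗ (φJ ⊗ φL)))    ∎
  where
  open ≐-Reasoning
  φI = phi A I
  φJ = phi A J
  φK = phi A K
  φL = phi A L

volume-swap-last : ∀ A {I J K L} → K ≢ L → volume A I J K L ≐ (-1ℤ · volume A I J L K)
volume-swap-last A {I} {J} {K} {L} K≢L =
  ≐-trans (⊗-congʳ (phi2 A I J) (phi-anticomm A K≢L)) (⊗-·-comm -1ℤ (phi2 A I J) (phi2 A L K))

phi2-by-volume : ∀ A {I J K L} c → volume A I J K L ≐ (c · grading) →
                 phi2 A I J ≐ (c · (grading ⊗ phi2 A L K))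
phi2-by-volume A {I} {J} {K} {L} c V≐cG = begin
  φIJ                        ≈⟨ ⊗-identityʳ φIJ ⟨
  (φIJ ⊗ 𝟙)                  ≈⟨ ⊗-congʳ φIJ (phi2-inverse A K L) ⟨
  (φIJ ⊗ (φKL ⊗ φLK))        ≈⟨ ⊗-assoc φIJ φKL φLK ⟨
  ((φIJ ⊗ φKL) ⊗ φLK)        ≈⟨ ⊗-congˡ φLK V≐cG ⟩
  ((c · grading) ⊗ φLK)      ≈⟨ ·-⊗-assoc c grading φLK ⟩
  (c · (grading ⊗ φLK))      ∎
  where
  open ≐-Reasoning
  φIJ = phi2 A I J
  φKL = phi2 A K L
  φLK = phi2 A L K

phi2-products-by-volume :
  ∀ A A' {I J K L} c c' → K ≢ L →
  volume A I J K L ≐ (c · grading) → volume A' I J K L ≐ (c' · grading) →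
  (phi2 A I J ⊗ phi2 A' I J) ≐ ((c * c') · (phi2 A K L ⊗ phi2 A' K L))
phi2-products-by-volume A A' {I} {J} {K} {L} c c' K≢L V≐cG V'≐c'G = begin
  (phi2 A I J ⊗ phi2 A' I J)
    ≈⟨ ⊗-cong (phi2-by-volume A c V≐cG) (phi2-by-volume A' c' V'≐c'G) ⟩
  ((c · (grading ⊗ φLK)) ⊗ (c' · (grading ⊗ φ'LK)))
    ≈⟨ ·-⊗-· c c' (grading ⊗ φLK) (grading ⊗ φ'LK) ⟩
  ((c * c') · ((grading ⊗ φLK) ⊗ (grading ⊗ φ'LK)))
    ≈⟨ ·-cong (c * c') (grading-cancel φLK φ'LK (grading-comm-phi2 A L K)) ⟩
  ((c * c') · (φLK ⊗ φ'LK))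
    ≈⟨ ·-cong (c * c') (⊗-cong (phi-anticomm A L≢K) (phi-anticomm A' L≢K)) ⟩
  ((c * c') · ((-1ℤ · φKL) ⊗ (-1ℤ · φ'KL)))
    ≈⟨ ·-cong (c * c') (·-⊗-· -1ℤ -1ℤ φKL φ'KL) ⟩
  ((c * c') · (1ℤ · (φKL ⊗ φ'KL)))
    ≈⟨ ·-cong (c * c') (1· (φKL ⊗ φ'KL)) ⟩
  ((c * c') · (φKL ⊗ φ'KL))
    ∎
  where
  open ≐-Reasoning
  φKL = phi2 A K L
  φ'KL = phi2 A' K L
  φLK = phi2 A L K
  φ'LK = phi2 A' L K
  L≢K = ≢-sym K≢L

data Complementary : Color → Color → Color → Color → Set where
  12∣34 : Complementary c1 c2 c3 c4
  13∣24 : Complementary c1 c3 c2 c4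
  14∣23 : Complementary c1 c4 c2 c3
  34∣12 : Complementary c3 c4 c1 c2
  24∣13 : Complementary c2 c4 c1 c3
  23∣14 : Complementary c2 c3 c1 c4

complementary : ∀ {I J K L} → I < J → K < L → K ≢ I → K ≢ J → L ≢ I → L ≢ J →
                Complementary I J K L
complementary {zero} {suc zero} {suc (suc zero)} {suc (suc (suc zero))} _ _ _ _ _ _ = 12∣34
complementary {zero} {suc (suc zero)} {suc zero} {suc (suc (suc zero))} _ _ _ _ _ _ = 13∣24
complementary {zero} {suc (suc (suc zero))} {suc zero} {suc (suc zero)} _ _ _ _ _ _ = 14∣23
complementary {suc (suc zero)} {suc (suc (suc zero))} {zero} {suc zero} _ _ _ _ _ _ = 34∣12
complementary {suc zero} {suc (suc (suc zero))} {zero} {suc (suc zero)} _ _ _ _ _ _ = 24∣13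
complementary {suc zero} {suc (suc zero)} {zero} {suc (suc (suc zero))} _ _ _ _ _ _ = 23∣14
complementary {suc _} {suc zero} (s≤s ())
complementary {suc (suc _)} {suc (suc zero)} (s≤s (s≤s ()))
complementary {suc (suc (suc _))} {suc (suc (suc zero))} (s≤s (s≤s (s≤s ())))
complementary {K = suc _} {suc zero} _ (s≤s ())
complementary {K = suc (suc _)} {suc (suc zero)} _ (s≤s (s≤s ()))
complementary {K = suc (suc (suc _))} {suc (suc (suc zero))} _ (s≤s (s≤s (s≤s ())))
complementary {zero} {_} {zero} _ _ K≢I _ _ _ = ⊥-elim (K≢I refl)
complementary {suc zero} {_} {suc zero} _ _ K≢I _ _ _ = ⊥-elim (K≢I refl)
complementary {_} {suc zero} {suc zero} _ _ _ K≢J _ _ = ⊥-elim (K≢J refl)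
complementary {_} {suc (suc zero)} {suc (suc zero)} _ _ _ K≢J _ _ = ⊥-elim (K≢J refl)
complementary {suc zero} {_} {_} {suc zero} _ _ _ _ L≢I _ = ⊥-elim (L≢I refl)
complementary {suc (suc zero)} {_} {_} {suc (suc zero)} _ _ _ _ L≢I _ = ⊥-elim (L≢I refl)
complementary {_} {suc (suc zero)} {_} {suc (suc zero)} _ _ _ _ _ L≢J = ⊥-elim (L≢J refl)
complementary {_} {suc (suc (suc zero))} {_} {suc (suc (suc zero))} _ _ _ _ _ L≢J = ⊥-elim (L≢J refl)

VolumeSign : Color → Color → Color → Color → Set
VolumeSign I J K L =
  Σ ℤ λ s → (s * s ≡ 1ℤ) × (∀ A → volume A I J K L ≐ (s · volume A c1 c2 c3 c4))

volume-swap-pairs : ∀ {I J K L} → I ≢ K → I ≢ L → J ≢ K → J ≢ L →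
                    VolumeSign I J K L → VolumeSign K L I J
volume-swap-pairs I≢K I≢L J≢K J≢L (s , s²≡1 , reorder) =
  s , s²≡1 , λ A → ≐-trans (phi2-comm-phi2 A I≢K I≢L J≢K J≢L) (reorder A)

volume-reorder : ∀ {I J K L} → Complementary I J K L → VolumeSign I J K L
volume-reorder 12∣34 = 1ℤ , refl , λ A → ≐-sym (1· (volume A c1 c2 c3 c4))
volume-reorder 13∣24 = -1ℤ , refl , λ A → volume-swap-middle A (λ ())
volume-reorder 14∣23 = 1ℤ , refl , λ A →
  ≐-trans (volume-swap-middle A (λ ()))
          (≐-trans (·-cong -1ℤ (volume-swap-last A (λ ()))) (·-· -1ℤ -1ℤ (volume A c1 c2 c3 c4)))
volume-reorder 34∣12 = volume-swap-pairs (λ ()) (λ ()) (λ ()) (λ ()) (volume-reorder 12∣34)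
volume-reorder 24∣13 = volume-swap-pairs (λ ()) (λ ()) (λ ()) (λ ()) (volume-reorder 13∣24)
volume-reorder 23∣14 = volume-swap-pairs (λ ()) (λ ()) (λ ()) (λ ()) (volume-reorder 14∣23)

phi2-products-by-chirality :
  ∀ A A' {χ χ' I J K L} → K ≢ L → VolumeSign I J K L →
  (phi A c1 ⊗ phi A c2 ⊗ phi A c3 ⊗ phi A c4) ≐ chiBlock χ →
  (phi A' c1 ⊗ phi A' c2 ⊗ phi A' c3 ⊗ phi A' c4) ≐ chiBlock χ' →
  (phi2 A I J ⊗ phi2 A' I J) ≐ ((χ * χ') · (phi2 A K L ⊗ phi2 A' K L))
phi2-products-by-chirality A A' {χ} {χ'} {I} {J} {K} {L} K≢L (s , s²≡1 , reorder) Γ≐χ Γ'≐χ' =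
  ≐-trans (phi2-products-by-volume A A' (s * χ) (s * χ') K≢L (signed A Γ≐χ) (signed A' Γ'≐χ'))
          (λ x y → cong (_* (phi2 A K L ⊗ phi2 A' K L) x y) (unit-cancels {s} s²≡1 χ χ'))
  where
  signed : ∀ B {x} → (phi B c1 ⊗ phi B c2 ⊗ phi B c3 ⊗ phi B c4) ≐ chiBlock x →
           volume B I J K L ≐ ((s * x) · grading)
  signed B {x} Γ≐x = ≐-trans (reorder B) (≐-trans (·-cong s (volume-chiBlock B Γ≐x)) (·-· s x grading))

lemma5p1 : (A A' : Adinkra) (χ χ' : ℤ) → IsChirality A χ → IsChirality A' χ' →
    (I J K L : Fin 4) → I < J → K < L →
    K ≢ I → K ≢ J → L ≢ I → L ≢ J →
    (phi2 A I J ⊗ phi2 A' I J) ≐ ((χ * χ') · (phi2 A K L ⊗ phi2 A' K L))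
lemma5p1 A A' χ χ' (_ , Γ≐χ) (_ , Γ'≐χ') I J K L I<J K<L K≢I K≢J L≢I L≢J =
  phi2-products-by-chirality A A' (<⇒≢ K<L)
    (volume-reorder (complementary I<J K<L K≢I K≢J L≢I L≢J)) Γ≐χ Γ'≐χ'
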